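{- Let $k\geq 2$ be an integer, and let $\kappa_{2k-1,2k,2k+1}$ be the $(2k-1,2k,2k+1)$-core partition of largest size which has the larger number of parts (among the $(2k-1,2k,2k+1)$-cores of largest size). Then, in exponential notation, $$\kappa_{2k-1,2k,2k+1} = \left(\left\{(k-1)^2\right\}^2, \left\{(k-2)^2\right\}^4, \dots, 16^{2k-8}, 9^{2k-6}, 4^{2k-4}, 1^{2k-2}\right),$$ i.e. for each $j=1,\dots,k-1$ the part $j^2$ occurs with multiplicity exactly $2(k-j)$, and there are no other parts.
   Context: A hook of a box in the Young diagram of a partition consists of the box together with the boxes to its right in its row and below it in its column; its length is the number of these boxes. A $t$-core is a partition with no hook of length $t$, and a $(2k-1,2k,2k+1)$-core is a partition that is simultaneously a $(2k-1)$-core, a $2k$-core and a $(2k+1)$-core. There are finitely many such cores; the maximal size is attained by exactly two partitions, which are conjugate to each other, and $\kappa_{2k-1,2k,2k+1}$ is chosen to be the one with more parts. Exponential notation $a^m$ means the part $a$ repeated $m$ times. -}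

module Defs where

open import Data.Nat using (ℕ; zero; suc; _+_; _*_; _∸_; _<_; _≥_; _<?_)
open import Data.List using (List; []; _∷_; length; filter; drop; replicate; map; concat; downFrom)
open import Data.Nat.ListAction using (sum)
open import Data.List.Relation.Unary.All using (All)
open import Data.List.Relation.Unary.Linked using (Linked)
open import Data.Product using (_×_)
open import Relation.Binary.PropositionalEquality using (_≢_)

IsPartition : List ℕ → Set
IsPartition μ = Linked _≥_ μ × All (0 <_) μ

size : List ℕ → ℕ
size = sum

-- the i-th part (0-indexed), 0 beyond the last part
part : List ℕ → ℕ → ℕ
part []       _       = 0
part (p ∷ μ)  zero    = p
part (p ∷ μ)  (suc i) = part μ i

-- The box (i , j) (row i, column j, 0-indexed) lies in the diagram iff j < part μ i.
-- arm: boxes to its right in its row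
arm : List ℕ → ℕ → ℕ → ℕ
arm μ i j = part μ i ∸ suc j

leg : List ℕ → ℕ → ℕ → ℕ
leg μ i j = length (filter (j <?_) (drop (suc i) μ))

hookLength : List ℕ → ℕ → ℕ → ℕ
hookLength μ i j = 1 + arm μ i j + leg μ i j

IsCore : ℕ → List ℕ → Set
IsCore t μ = ∀ i j → j < part μ i → hookLength μ i j ≢ t

IsCore3 : ℕ → List ℕ → Set
IsCore3 k μ = IsCore (2 * k ∸ 1) μ × IsCore (2 * k) μ × IsCore (2 * k + 1) μ

-- The explicit partition ((k-1)^2)^2, ((k-2)^2)^4, ..., 4^(2k-4), 1^(2k-2):
-- for j = k-1 down to 1, the part j^2 with multiplicity 2(k-j).
kappaFormula : ℕ → List ℕ
kappaFormula k =
  concat (map (λ m → replicate (2 * (k ∸ suc m)) (suc m * suc m)) (downFrom (k ∸ 1)))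

-- Encode a partition by its β-numbers, the hook lengths of its first column: μ is a t-core iff
-- its β-set B is closed under b ↦ b − t. With s = 2k − 1, the β-set of an (s, s+1, s+2)-core
-- therefore avoids the numerical semigroup ⟨s, s+1, s+2⟩, whose gaps are the numbers strictly
-- between q(s+2) and (q+1)s for q < k − 1. κ is the partition whose β-set is the whole gap set,
-- so every other core has strictly fewer β-numbers, that is, fewer parts.
-- For the size, cut B into the layers [qs, (q+1)s). Closure under s, s+1 and s+2 makes each
-- layer at least two elements shorter than the one below it, so filling every layer from the
-- top bounds |μ| by the size of the staircase with layer sizes c, c−2, c−4, …, which grows with
-- c < s. For c = s − 1 the staircase is the gap set, and closed forms show its size is |κ|.

module Submission where

open import Defs
open import Data.Nat
open import Data.Nat.Properties
open import Data.Nat.Tactic.RingSolver using (solve-∀)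
open import Data.Nat.DivMod using (_/_; _%_; m≡m%n+[m/n]*n; m%n<n)
open import Data.Nat.ListAction using (sum)
open import Data.Nat.ListAction.Properties using (sum-++)
open import Data.List using (List; []; _∷_; _++_; length; map; filter; replicate; concat; downFrom)
open import Data.List.Properties using (filter-none; filter-accept; ∷-injective; length-++; length-map; length-replicate)
open import Data.List.Relation.Unary.All as All using (All; []; _∷_)
open import Data.List.Relation.Unary.All.Properties using (replicate⁺) renaming (++⁺ to All-++⁺)
open import Data.List.Relation.Unary.AllPairs using (AllPairs; []; _∷_)
import Data.List.Relation.Unary.AllPairs.Properties as AllPairs
open import Data.List.Relation.Unary.Linked.Properties using (Linked⇒AllPairs; AllPairs⇒Linked)
open import Data.List.Relation.Unary.Any using (here; there)
open import Data.List.Membership.Propositional using (_∈_; _∉_)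
open import Data.List.Membership.Propositional.Properties using (∈-++⁺ˡ; ∈-++⁺ʳ; ∈-++⁻; ∈-map⁺; ∈-map⁻)
open import Data.List.Relation.Binary.Subset.Propositional using (_⊆_)
open import Data.Product using (_×_; ∃-syntax; _,_; proj₁; proj₂)
open import Data.Sum using (_⊎_; inj₁; inj₂)
open import Data.Empty using (⊥; ⊥-elim)
open import Relation.Nullary using (¬_; yes; no)
open import Relation.Binary.PropositionalEquality
  using (_≡_; _≢_; refl; sym; trans; cong; cong₂; subst; subst₂; module ≡-Reasoning)
open import Relation.Binary.Definitions using (tri<; tri≈; tri>)

partition-decreasing : ∀ {μ} → IsPartition μ → AllPairs _≥_ μ
partition-decreasing (μ-linked , _) = Linked⇒AllPairs (λ x≥y y≥z → ≤-trans y≥z x≥y) μ-linked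

-- β-numbers

betaNumbers : List ℕ → List ℕ
betaNumbers []      = []
betaNumbers (x ∷ ν) = x + length ν ∷ betaNumbers ν

betaSize : List ℕ → ℕ
betaSize []      = 0
betaSize (b ∷ B) = b ∸ length B + betaSize B

length-betaNumbers : ∀ μ → length (betaNumbers μ) ≡ length μ
length-betaNumbers []      = refl
length-betaNumbers (x ∷ μ) = cong suc (length-betaNumbers μ)

size≡betaSize∘betaNumbers : ∀ μ → size μ ≡ betaSize (betaNumbers μ)
size≡betaSize∘betaNumbers []      = refl
size≡betaSize∘betaNumbers (x ∷ μ) = cong₂ _+_ (sym first) (size≡betaSize∘betaNumbers μ)
  where
  first : x + length μ ∸ length (betaNumbers μ) ≡ x
  first = trans (cong (x + length μ ∸_) (length-betaNumbers μ)) (m+n∸n≡m x (length μ))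

betaNumbers-injective : ∀ μ ν → betaNumbers μ ≡ betaNumbers ν → μ ≡ ν
betaNumbers-injective []      []      _  = refl
betaNumbers-injective []      (_ ∷ _) ()
betaNumbers-injective (_ ∷ _) []      ()
betaNumbers-injective (x ∷ μ) (y ∷ ν) eq with ∷-injective eq
... | x+n≡y+m , rest with betaNumbers-injective μ ν rest
... | refl = cong (_∷ μ) (+-cancelʳ-≡ (length μ) x y x+n≡y+m)

betaNumbers-< : ∀ {x ν} → AllPairs _≥_ (x ∷ ν) → All (_< x + length ν) (betaNumbers ν)
betaNumbers-< {x} {[]}    _                   = []
betaNumbers-< {x} {y ∷ ν} ((y≤x ∷ _) ∷ ν-dec) =
  y+n<x+1+n ∷ All.map (λ b<y+n → <-trans b<y+n y+n<x+1+n) (betaNumbers-< ν-dec)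
  where
  y+n<x+1+n : y + length ν < x + suc (length ν)
  y+n<x+1+n = subst (y + length ν <_) (sym (+-suc x (length ν))) (s≤s (+-monoˡ-≤ (length ν) y≤x))

betaNumbers-decreasing : ∀ {μ} → AllPairs _≥_ μ → AllPairs _>_ (betaNumbers μ)
betaNumbers-decreasing []              = []
betaNumbers-decreasing (x≥ν ∷ ν-dec) = betaNumbers-< (x≥ν ∷ ν-dec) ∷ betaNumbers-decreasing ν-dec

betaNumbers-positive : ∀ {μ} → All (0 <_) μ → All (0 <_) (betaNumbers μ)
betaNumbers-positive []         = []
betaNumbers-positive (x>0 ∷ ps) = ≤-trans x>0 (m≤m+n _ _) ∷ betaNumbers-positive ps

betaNumbers-++ : ∀ xs ys → betaNumbers (xs ++ ys) ≡ map (_+ length ys) (betaNumbers xs) ++ betaNumbers ys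
betaNumbers-++ []       ys = refl
betaNumbers-++ (x ∷ xs) ys =
  cong₂ _∷_ (trans (cong (x +_) (length-++ xs)) (sym (+-assoc x (length xs) (length ys)))) (betaNumbers-++ xs ys)

∈betaNumbers-replicate⁻ : ∀ c v {y} → y ∈ betaNumbers (replicate c v) → v ≤ y × y < v + c
∈betaNumbers-replicate⁻ (suc c) v (here refl) rewrite length-replicate c {v} = m≤m+n v c , +-monoʳ-< v (n<1+n c)
∈betaNumbers-replicate⁻ (suc c) v (there y∈) with ∈betaNumbers-replicate⁻ c v y∈
... | v≤y , y<v+c = v≤y , <-≤-trans y<v+c (+-monoʳ-≤ v (n≤1+n c))

∈betaNumbers-replicate⁺ : ∀ c v {y} → v ≤ y → y < v + c → y ∈ betaNumbers (replicate c v)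
∈betaNumbers-replicate⁺ zero    v v≤y y<v+0 = ⊥-elim (<⇒≱ y<v+0 (subst (_≤ _) (sym (+-identityʳ v)) v≤y))
∈betaNumbers-replicate⁺ (suc c) v {y} v≤y y<v+1+c with y ≟ v + c
... | yes refl = here (cong (v +_) (sym (length-replicate c)))
... | no y≢v+c = there (∈betaNumbers-replicate⁺ c v v≤y (≤∧≢⇒< (≤-pred (subst (suc y ≤_) (+-suc v c) y<v+1+c)) y≢v+c))

-- First-row hooks and t-cores

hookLength-noLeg : ∀ {x ν j} → j < x → All (_≤ j) ν → hookLength (x ∷ ν) 0 j ≡ x ∸ j
hookLength-noLeg {x} {ν} {j} j<x ν≤j = begin
  1 + (x ∸ suc j) + length (filter (j <?_) ν)
    ≡⟨ cong (λ L → 1 + (x ∸ suc j) + length L) (filter-none (j <?_) (All.map ≤⇒≯ ν≤j)) ⟩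
  1 + (x ∸ suc j) + 0
    ≡⟨ +-identityʳ _ ⟩
  1 + (x ∸ suc j)
    ≡⟨ sym (+-∸-assoc 1 j<x) ⟩
  x ∸ j ∎
  where open ≡-Reasoning

hookLength-leg : ∀ {y d ν j} → j < y → hookLength (y + d ∷ y ∷ ν) 0 j ≡ suc d + hookLength (y ∷ ν) 0 j
hookLength-leg {y} {d} {ν} {j} j<y = begin
  1 + (y + d ∸ suc j) + length (filter (j <?_) (y ∷ ν))
    ≡⟨ cong (λ L → 1 + (y + d ∸ suc j) + length L) (filter-accept (j <?_) j<y) ⟩
  1 + (y + d ∸ suc j) + suc c
    ≡⟨ cong (λ a → 1 + a + suc c) (+-∸-comm d j<y) ⟩
  1 + (y ∸ suc j + d) + suc c
    ≡⟨ rearrange (y ∸ suc j) d c ⟩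
  suc d + (1 + (y ∸ suc j) + c) ∎
  where
  open ≡-Reasoning
  c = length (filter (j <?_) ν)
  rearrange : ∀ a d c → 1 + (a + d) + suc c ≡ suc d + (1 + a + c)
  rearrange = solve-∀

y+d+[1+n]≡1+d+[y+n] : ∀ y d n → y + d + suc n ≡ suc d + (y + n)
y+d+[1+n]≡1+d+[y+n] = solve-∀

firstRowHook-noLeg : ∀ {x ν t} → 1 ≤ t → t ≤ x → All (_≤ x ∸ t) ν → ∃[ j ] j < x × hookLength (x ∷ ν) 0 j ≡ t
firstRowHook-noLeg {x} {ν} {t} 1≤t t≤x ν≤ = x ∸ t , j<x , trans (hookLength-noLeg j<x ν≤) (m∸[m∸n]≡n t≤x)
  where j<x = ∸-monoʳ-< 1≤t t≤x

-- The first-row hook lengths are the β₀ − b with b < β₀ not a β-number (this lemma and the next).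
firstRowHook⊎betaNumber : ∀ {x ν} → AllPairs _≥_ (x ∷ ν) → ∀ t → 1 ≤ t → t ≤ x + length ν →
  (∃[ j ] j < x × hookLength (x ∷ ν) 0 j ≡ t) ⊎ (x + length ν ∸ t ∈ betaNumbers ν)
firstRowHook⊎betaNumber {x} {[]} _ t 1≤t t≤x+0 = inj₁ (firstRowHook-noLeg 1≤t (subst (t ≤_) (+-identityʳ x) t≤x+0) [])
firstRowHook⊎betaNumber {x} {y ∷ ν} ((y≤x ∷ _) ∷ ν-dec@(ν≤y ∷ _)) t 1≤t t≤β with m≤n⇒∃[o]m+o≡n y≤x
... | d , refl with <-cmp t (suc d)
... | tri< t<1+d _ _ =
  inj₁ (firstRowHook-noLeg 1≤t (≤-trans t≤d (m≤n+m d y)) (y≤j ∷ All.map (λ z≤y → ≤-trans z≤y y≤j) ν≤y))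
  where
  t≤d = ≤-pred t<1+d
  y≤j : y ≤ y + d ∸ t
  y≤j = subst (y ≤_) (sym (+-∸-assoc y t≤d)) (m≤m+n y (d ∸ t))
... | tri≈ _ refl _ = inj₂ (here (trans (cong (_∸ suc d) (y+d+[1+n]≡1+d+[y+n] y d (length ν)))
                                         (m+n∸m≡n (suc d) (y + length ν))))
... | tri> _ _ 1+d<t with m≤n⇒∃[o]m+o≡n 1+d<t
... | o , refl with firstRowHook⊎betaNumber ν-dec (suc o) (s≤s z≤n) 1+o≤β₁
  where
  1+o≤β₁ : suc o ≤ y + length ν
  1+o≤β₁ = +-cancelˡ-≤ (suc d) (suc o) (y + length ν)
             (subst₂ _≤_ (sym (+-suc (suc d) o)) (y+d+[1+n]≡1+d+[y+n] y d (length ν)) t≤β)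
... | inj₁ (j , j<y , hook≡) = inj₁ (j , ≤-trans j<y (m≤m+n y d) , (begin
  hookLength (y + d ∷ y ∷ ν) 0 j ≡⟨ hookLength-leg j<y ⟩
  suc d + hookLength (y ∷ ν) 0 j ≡⟨ cong (suc d +_) hook≡ ⟩
  suc d + suc o                  ≡⟨ +-suc (suc d) o ⟩
  suc (suc d) + o ∎))
  where open ≡-Reasoning
... | inj₂ β₁-t∈ = inj₂ (there (subst (_∈ betaNumbers ν) (sym shifted) β₁-t∈))
  where
  shifted : y + d + suc (length ν) ∸ (suc (suc d) + o) ≡ y + length ν ∸ suc o
  shifted = begin
    y + d + suc n ∸ (suc (suc d) + o) ≡⟨ cong₂ _∸_ (y+d+[1+n]≡1+d+[y+n] y d n) (sym (+-suc (suc d) o)) ⟩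
    suc d + (y + n) ∸ (suc d + suc o) ≡⟨ [m+n]∸[m+o]≡n∸o (suc d) (y + n) (suc o) ⟩
    y + n ∸ suc o ∎
    where
    open ≡-Reasoning
    n = length ν

firstRowHook∉betaNumbers-noLeg : ∀ {x ν j} → j < x → AllPairs _≥_ (j ∷ ν) →
  hookLength (x ∷ ν) 0 j ≤ x + length ν × x + length ν ∸ hookLength (x ∷ ν) 0 j ∉ betaNumbers ν
firstRowHook∉betaNumbers-noLeg {x} {ν} {j} j<x j-dec@(ν≤j ∷ _) rewrite hookLength-noLeg j<x ν≤j =
  ≤-trans (m∸n≤m x j) (m≤m+n x (length ν)) ,
  λ β∈ → <-irrefl refl (subst (_< j + length ν) value (All.lookup (betaNumbers-< j-dec) β∈))
  where
  value : x + length ν ∸ (x ∸ j) ≡ j + length ν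
  value = trans (+-∸-comm (length ν) (m∸n≤m x j)) (cong (_+ length ν) (m∸[m∸n]≡n (<⇒≤ j<x)))

firstRowHook∉betaNumbers : ∀ {x ν} → AllPairs _≥_ (x ∷ ν) → ∀ {j} → j < x →
  hookLength (x ∷ ν) 0 j ≤ x + length ν × x + length ν ∸ hookLength (x ∷ ν) 0 j ∉ betaNumbers ν
firstRowHook∉betaNumbers {x} {[]} _ j<x = firstRowHook∉betaNumbers-noLeg j<x ([] ∷ [])
firstRowHook∉betaNumbers {x} {y ∷ ν} ((y≤x ∷ _) ∷ ν-dec@(ν≤y ∷ _)) {j} j<x with j <? y
... | no j≮y = firstRowHook∉betaNumbers-noLeg j<x ((y≤j ∷ All.map (λ z≤y → ≤-trans z≤y y≤j) ν≤y) ∷ ν-dec)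
  where y≤j = ≮⇒≥ j≮y
... | yes j<y with m≤n⇒∃[o]m+o≡n y≤x
... | d , refl with firstRowHook∉betaNumbers ν-dec j<y
... | h≤β₁ , β₁-h∉ rewrite hookLength-leg {y} {d} {ν} j<y = bound , notIn
  where
  n = length ν
  h = hookLength (y ∷ ν) 0 j
  bound : suc d + h ≤ y + d + suc n
  bound = subst (suc d + h ≤_) (sym (y+d+[1+n]≡1+d+[y+n] y d n)) (+-monoʳ-≤ (suc d) h≤β₁)
  value : y + d + suc n ∸ (suc d + h) ≡ y + n ∸ h
  value = trans (cong (_∸ (suc d + h)) (y+d+[1+n]≡1+d+[y+n] y d n)) ([m+n]∸[m+o]≡n∸o (suc d) (y + n) h)
  notIn : y + d + suc n ∸ (suc d + h) ∉ betaNumbers (y ∷ ν)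
  notIn (here eq)  = <-irrefl (trans (sym value) eq) (∸-monoʳ-< (s≤s z≤n) h≤β₁)
  notIn (there β∈) = β₁-h∉ (subst (_∈ betaNumbers ν) value β∈)

SubClosed : ℕ → List ℕ → Set
SubClosed t B = ∀ {b} → b ∈ B → t ≤ b → b ∸ t ∈ B

core⇒subClosed : ∀ {t μ} → 1 ≤ t → AllPairs _≥_ μ → IsCore t μ → SubClosed t (betaNumbers μ)
core⇒subClosed {t} {x ∷ ν} 1≤t μ-dec core (here refl) t≤β₀
  with firstRowHook⊎betaNumber μ-dec t 1≤t t≤β₀
... | inj₁ (j , j<x , hook≡t) = ⊥-elim (core 0 j j<x hook≡t)
... | inj₂ β₀-t∈ = there β₀-t∈
core⇒subClosed {t} {x ∷ ν} 1≤t (_ ∷ ν-dec) core (there b∈) t≤b =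
  there (core⇒subClosed 1≤t ν-dec (λ i → core (suc i)) b∈ t≤b)

subClosed⇒core : ∀ {t μ} → 1 ≤ t → AllPairs _≥_ μ → SubClosed t (betaNumbers μ) → IsCore t μ
subClosed⇒core {t} {x ∷ ν} 1≤t μ-dec closed zero j j<x refl with firstRowHook∉betaNumbers μ-dec j<x
... | hook≤β₀ , β₀-hook∉ with closed (here refl) hook≤β₀
... | here eq  = <-irrefl eq (∸-monoʳ-< 1≤t hook≤β₀)
... | there β∈ = β₀-hook∉ β∈
subClosed⇒core {t} {x ∷ ν} 1≤t μ-dec@(_ ∷ ν-dec) closed (suc i) = subClosed⇒core 1≤t ν-dec closedν i
  where
  closedν : SubClosed t (betaNumbers ν)
  closedν b∈ t≤b with closed (there b∈) t≤b
  ... | here eq    = ⊥-elim (<-irrefl eq (≤-<-trans (m∸n≤m _ t) (All.lookup (betaNumbers-< μ-dec) b∈)))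
  ... | there b-t∈ = b-t∈

-- The semigroup ⟨s, s+1, s+2⟩

-- Sums of q numbers from {s, s+1, s+2} fill the interval [q s, q (s+2)].
InSemigroup : ℕ → ℕ → Set
InSemigroup s y = ∃[ q ] q * s ≤ y × y ≤ q * (2 + s)

SubClosed₃ : ℕ → List ℕ → Set
SubClosed₃ s B = ∀ d → d ≤ 2 → SubClosed (d + s) B

subClosed₃⇒∉semigroup : ∀ {s B} → SubClosed₃ s B → All (0 <_) B → ∀ {b} → b ∈ B → ¬ InSemigroup s b
subClosed₃⇒∉semigroup {s} {B} closed positive b∈ (q , lo , hi) = descend q b∈ lo hi
  where
  descend : ∀ q {b} → b ∈ B → q * s ≤ b → b ≤ q * (2 + s) → ⊥
  descend zero    b∈ _  b≤0 = <⇒≱ (All.lookup positive b∈) b≤0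
  descend (suc q) b∈ lo hi with m≤n⇒∃[o]m+o≡n (≤-trans (m≤m+n s (q * s)) lo)
  ... | z , refl with z ≤? q * (2 + s)
  ... | yes z≤Q = descend q (subst (_∈ B) (m+n∸m≡n s z) (closed 0 z≤n b∈ (m≤m+n s z))) (+-cancelˡ-≤ s _ _ lo) z≤Q
  -- b = s + z with Q < z ≤ Q + 2: subtracting s + (z − Q) lands exactly on Q = q (s+2).
  ... | no z≰Q = descend q (subst (_∈ B) lands (closed d d≤2 b∈ d+s≤b)) (*-monoʳ-≤ q (m≤n+m s 2)) ≤-refl
    where
    Q = q * (2 + s)
    d = z ∸ Q
    d≤2 : d ≤ 2
    d≤2 = m≤n+o⇒m∸n≤o z Q (+-cancelˡ-≤ s z (Q + 2) (subst (s + z ≤_) (reorder s Q) hi))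
      where reorder : ∀ s Q → 2 + s + Q ≡ s + (Q + 2)
            reorder = solve-∀
    d+s≤b : d + s ≤ s + z
    d+s≤b = subst (_≤ s + z) (+-comm s d) (+-monoʳ-≤ s (m∸n≤m z Q))
    lands : s + z ∸ (d + s) ≡ Q
    lands = begin
      s + z ∸ (d + s) ≡⟨ cong (s + z ∸_) (+-comm d s) ⟩
      s + z ∸ (s + d) ≡⟨ [m+n]∸[m+o]≡n∸o s z d ⟩
      z ∸ (z ∸ Q)     ≡⟨ m∸[m∸n]≡n (<⇒≤ (≰⇒> z≰Q)) ⟩
      Q ∎
      where open ≡-Reasoning

semigroup-+ : ∀ {s y d} → InSemigroup s y → d ≤ 2 → InSemigroup s (d + s + y)
semigroup-+ {s} {y} {d} (q , lo , hi) d≤2 = suc q , +-mono-≤ (m≤n+m s d) lo , +-mono-≤ (+-monoˡ-≤ s d≤2) hi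

∉semigroup-∸ : ∀ {s b d} → ¬ InSemigroup s b → d ≤ 2 → d + s ≤ b → ¬ InSemigroup s (b ∸ (d + s))
∉semigroup-∸ b∉ d≤2 d+s≤b inS = b∉ (subst (InSemigroup _) (m+[n∸m]≡n d+s≤b) (semigroup-+ inS d≤2))

BetweenLayers : ℕ → ℕ → ℕ → Set
BetweenLayers s q y = q * (2 + s) < y × y < suc q * s

betweenLayers⇒∉semigroup : ∀ {s q y} → BetweenLayers s q y → ¬ InSemigroup s y
betweenLayers⇒∉semigroup {s} {q} {y} (lo , hi) (p , plo , phi) with p ≤? q
... | yes p≤q = <⇒≱ lo (≤-trans phi (*-monoˡ-≤ (2 + s) p≤q))
... | no p≰q  = <⇒≱ hi (≤-trans (*-monoˡ-≤ s (≰⇒> p≰q)) plo)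

-- Strictly decreasing lists

allPairs-replicate : ∀ {A : Set} {R : A → A → Set} c {v} → R v v → AllPairs R (replicate c v)
allPairs-replicate zero    _   = []
allPairs-replicate (suc c) Rvv = replicate⁺ c Rvv ∷ allPairs-replicate c Rvv

∈⇒≤head : ∀ {x xs y} → AllPairs _>_ (x ∷ xs) → y ∈ x ∷ xs → y ≤ x
∈⇒≤head _               (here refl) = ≤-refl
∈⇒≤head (x>xs ∷ _) (there y∈) = <⇒≤ (All.lookup x>xs y∈)

decreasing-⊆ : ∀ {xs ys} → AllPairs _>_ xs → AllPairs _>_ ys → xs ⊆ ys →
  length xs ≤ length ys × (length xs ≡ length ys → xs ≡ ys)
decreasing-⊆ {[]} {[]}    _ _ _ = z≤n , λ _ → refl
decreasing-⊆ {[]} {_ ∷ _} _ _ _ = z≤n , λ ()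
decreasing-⊆ {x ∷ xs} {[]} _ _ xs⊆ with xs⊆ (here refl)
... | ()
decreasing-⊆ {x ∷ xs} {y ∷ ys} xs-dec@(x>xs ∷ xs-dec′) ys-dec@(_ ∷ ys-dec′) xs⊆ with <-cmp x y
... | tri> _ _ y<x = ⊥-elim (<⇒≱ y<x (∈⇒≤head ys-dec (xs⊆ (here refl))))
... | tri≈ _ refl _ with decreasing-⊆ xs-dec′ ys-dec′ tail⊆
  where
  tail⊆ : xs ⊆ ys
  tail⊆ z∈ with xs⊆ (there z∈)
  ... | here refl = ⊥-elim (<-irrefl refl (All.lookup x>xs z∈))
  ... | there z∈′ = z∈′
... | ≤len , ≡len⇒≡ = s≤s ≤len , λ eq → cong (x ∷_) (≡len⇒≡ (suc-injective eq))
decreasing-⊆ {x ∷ xs} {y ∷ ys} xs-dec (_ ∷ ys-dec′) xs⊆ | tri< x<y _ _ with decreasing-⊆ xs-dec ys-dec′ ⊆tail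
  where
  ⊆tail : x ∷ xs ⊆ ys
  ⊆tail z∈ with xs⊆ z∈
  ... | here refl = ⊥-elim (<-irrefl refl (≤-<-trans (∈⇒≤head xs-dec z∈) x<y))
  ... | there z∈′ = z∈′
... | ≤len , _ = m≤n⇒m≤1+n ≤len , λ eq → ⊥-elim (<-irrefl (suc-injective eq) ≤len)

length≤head : ∀ {x xs} → AllPairs _>_ (x ∷ xs) → length xs ≤ x
length≤head {x} {[]}     _                      = z≤n
length≤head {x} {y ∷ xs} ((y<x ∷ _) ∷ ys-dec) = ≤-trans (s≤s (length≤head ys-dec)) y<x

-- For decreasing B this is betaSize (map (l +_) B): the β-set B lifted above l unused positions.
liftedSize : ℕ → List ℕ → ℕ
liftedSize l B = l * length B + betaSize B

liftedSize-[] : ∀ l → liftedSize l [] ≡ 0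
liftedSize-[] l = trans (+-identityʳ (l * 0)) (*-zeroʳ l)

betaSize≤ : ∀ {t L} → AllPairs _>_ L → All (_< t) L → betaSize L ≤ length L * (t ∸ length L)
betaSize≤ {t} {[]}    _              _           = z≤n
betaSize≤ {t} {b ∷ L} (b>L ∷ L-dec) (b<t ∷ _) = begin
  b ∸ n + betaSize L        ≤⟨ +-monoʳ-≤ (b ∸ n) (betaSize≤ L-dec b>L) ⟩
  b ∸ n + n * (b ∸ n)       ≡⟨⟩
  suc n * (b ∸ n)           ≤⟨ *-monoʳ-≤ (suc n) (subst (b ∸ n ≤_) (∸-+-assoc t 1 n) (∸-monoˡ-≤ n (<⇒≤pred b<t))) ⟩
  suc n * (t ∸ suc n)       ∎
  where
  open ≤-Reasoning
  n = length L

length≤pred : ∀ {t L} → AllPairs _>_ L → All (0 <_) L → All (_< t) L → length L ≤ pred t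
length≤pred {t} {[]}        _              _            _           = z≤n
length≤pred {t} {suc b ∷ L} (b>L ∷ L-dec) (_ ∷ L>0) (b<t ∷ _) =
  ≤-trans (s≤s (length≤pred L-dec L>0 b>L)) (<⇒≤pred b<t)

sum-replicate : ∀ c v → sum (replicate c v) ≡ c * v
sum-replicate zero    v = refl
sum-replicate (suc c) v = cong (v +_) (sum-replicate c v)

∈⇒≤sum : ∀ {L y} → y ∈ L → y ≤ sum L
∈⇒≤sum {x ∷ L} (here refl) = m≤m+n x (sum L)
∈⇒≤sum {x ∷ L} (there y∈) = ≤-trans (∈⇒≤sum y∈) (m≤n+m (sum L) x)

withTwoBelow : List ℕ → List ℕ
withTwoBelow []           = []
withTwoBelow (x ∷ [])     = x ∷ x ∸ 1 ∷ x ∸ 2 ∷ []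
withTwoBelow (x ∷ y ∷ xs) = x ∷ withTwoBelow (y ∷ xs)

length-withTwoBelow : ∀ x xs → length (withTwoBelow (x ∷ xs)) ≡ length (x ∷ xs) + 2
length-withTwoBelow x []       = refl
length-withTwoBelow x (y ∷ xs) = cong suc (length-withTwoBelow y xs)

withTwoBelow-≤ : ∀ {m x xs} → All (_≤ m) (x ∷ xs) → All (_≤ m) (withTwoBelow (x ∷ xs))
withTwoBelow-≤ {m} {x} {[]}     (x≤m ∷ []) = x≤m ∷ ≤-trans (m∸n≤m x 1) x≤m ∷ ≤-trans (m∸n≤m x 2) x≤m ∷ []
withTwoBelow-≤ {m} {x} {y ∷ xs} (x≤m ∷ ys≤m) = x≤m ∷ withTwoBelow-≤ ys≤m

withTwoBelow-decreasing : ∀ {x xs} → AllPairs _>_ (x ∷ xs) → All (2 ≤_) (x ∷ xs) → AllPairs _>_ (withTwoBelow (x ∷ xs))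
withTwoBelow-decreasing {0}           {[]} _ (() ∷ _)
withTwoBelow-decreasing {1}           {[]} _ (s≤s () ∷ _)
withTwoBelow-decreasing {suc (suc x)} {[]} _ _ =
  (n<1+n _ ∷ ≤-trans (n<1+n x) (n≤1+n _) ∷ []) ∷ (n<1+n x ∷ []) ∷ [] ∷ []
withTwoBelow-decreasing {x} {y ∷ xs} ((y<x ∷ _) ∷ ys-dec@(y>xs ∷ _)) (_ ∷ ys≥2) =
  All.map (λ z≤y → ≤-<-trans z≤y y<x) (withTwoBelow-≤ (≤-refl ∷ All.map <⇒≤ y>xs)) ∷ withTwoBelow-decreasing ys-dec ys≥2

withTwoBelow-⊆ : ∀ {x xs ys} → (∀ {z} → z ∈ x ∷ xs → z ∈ ys × z ∸ 1 ∈ ys × z ∸ 2 ∈ ys) → withTwoBelow (x ∷ xs) ⊆ ys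
withTwoBelow-⊆ {x} {[]}     below (here refl)                 = proj₁ (below (here refl))
withTwoBelow-⊆ {x} {[]}     below (there (here refl))         = proj₁ (proj₂ (below (here refl)))
withTwoBelow-⊆ {x} {[]}     below (there (there (here refl))) = proj₂ (proj₂ (below (here refl)))
withTwoBelow-⊆ {x} {y ∷ xs} below (here refl)                 = proj₁ (below (here refl))
withTwoBelow-⊆ {x} {y ∷ xs} below (there z∈)                  = withTwoBelow-⊆ (λ z∈′ → below (there z∈′)) z∈

length+2≤ : ∀ {x xs ys} → AllPairs _>_ (x ∷ xs) → All (2 ≤_) (x ∷ xs) → AllPairs _>_ ys →
  (∀ {z} → z ∈ x ∷ xs → z ∈ ys × z ∸ 1 ∈ ys × z ∸ 2 ∈ ys) → length (x ∷ xs) + 2 ≤ length ys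
length+2≤ {x} {xs} xs-dec xs≥2 ys-dec below =
  subst (_≤ _) (length-withTwoBelow x xs)
    (proj₁ (decreasing-⊆ (withTwoBelow-decreasing xs-dec xs≥2) ys-dec (withTwoBelow-⊆ below)))

-- Staircases

stair : ℕ → List ℕ
stair zero          = []
stair (suc zero)    = 1 ∷ []
stair (suc (suc c)) = suc (suc c) ∷ stair c

sum-stair-mono₁ : ∀ c → sum (stair c) ≤ sum (stair (suc c))
sum-stair-mono₁ zero          = z≤n
sum-stair-mono₁ (suc zero)    = s≤s z≤n
sum-stair-mono₁ (suc (suc c)) = +-mono-≤ (n≤1+n (suc (suc c))) (sum-stair-mono₁ c)

sum-stair-even : ∀ u → sum (stair (2 * u)) ≡ u * (1 + u)
sum-stair-even zero    = refl
sum-stair-even (suc u) = begin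
  sum (stair (2 * suc u))            ≡⟨ cong (λ c → sum (stair c)) (*-suc 2 u) ⟩
  2 + 2 * u + sum (stair (2 * u))    ≡⟨ cong (2 + 2 * u +_) (sum-stair-even u) ⟩
  2 + 2 * u + u * (1 + u)            ≡⟨ step u ⟩
  suc u * (1 + suc u)                ∎
  where
  open ≡-Reasoning
  step : ∀ u → 2 + 2 * u + u * (1 + u) ≡ (1 + u) * (2 + u)
  step = solve-∀

sum-stair-odd : ∀ u → sum (stair (1 + 2 * u)) ≡ (1 + u) * (1 + u)
sum-stair-odd zero    = refl
sum-stair-odd (suc u) = begin
  sum (stair (1 + 2 * suc u))           ≡⟨ cong (λ c → sum (stair (1 + c))) (*-suc 2 u) ⟩
  3 + 2 * u + sum (stair (1 + 2 * u))   ≡⟨ cong (3 + 2 * u +_) (sum-stair-odd u) ⟩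
  3 + 2 * u + (1 + u) * (1 + u)         ≡⟨ step u ⟩
  (1 + suc u) * (1 + suc u)             ∎
  where
  open ≡-Reasoning
  step : ∀ u → 3 + 2 * u + (1 + u) * (1 + u) ≡ (2 + u) * (2 + u)
  step = solve-∀

data EvenOrOdd : ℕ → Set where
  even : ∀ u → EvenOrOdd (2 * u)
  odd  : ∀ u → EvenOrOdd (1 + 2 * u)

evenOrOdd : ∀ c → EvenOrOdd c
evenOrOdd zero    = even 0
evenOrOdd (suc c) with evenOrOdd c
... | even u = odd u
... | odd u  = subst EvenOrOdd (*-suc 2 u) (even (suc u))

module Layers (s : ℕ) where

  high : List ℕ → List ℕ
  high []      = []
  high (y ∷ B) with s ≤? y
  ... | yes _ = y ∷ high B
  ... | no _  = []

  low : List ℕ → List ℕ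
  low []      = []
  low (y ∷ B) with s ≤? y
  ... | yes _ = low B
  ... | no _  = y ∷ B

  high++low : ∀ B → high B ++ low B ≡ B
  high++low []      = refl
  high++low (y ∷ B) with s ≤? y
  ... | yes _ = cong (y ∷_) (high++low B)
  ... | no _  = refl

  high-≥ : ∀ B → All (s ≤_) (high B)
  high-≥ []      = []
  high-≥ (y ∷ B) with s ≤? y
  ... | yes s≤y = s≤y ∷ high-≥ B
  ... | no _    = []

  next : List ℕ → List ℕ
  next B = map (_∸ s) (high B)

  low-< : ∀ {B} → AllPairs _>_ B → All (_< s) (low B)
  low-< {[]}    _             = []
  low-< {y ∷ B} (y>B ∷ B-dec) with s ≤? y
  ... | yes _   = low-< B-dec
  ... | no s≰y = ≰⇒> s≰y ∷ All.map (λ z<y → <-trans z<y (≰⇒> s≰y)) y>B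

  low-decreasing : ∀ {B} → AllPairs _>_ B → AllPairs _>_ (low B)
  low-decreasing {[]}    _                    = []
  low-decreasing {y ∷ B} (y>B ∷ B-dec) with s ≤? y
  ... | yes _ = low-decreasing B-dec
  ... | no _  = y>B ∷ B-dec

  next-< : ∀ {y B} → All (_< y) B → All (_< y ∸ s) (next B)
  next-< {y} {[]}    []            = []
  next-< {y} {z ∷ B} (z<y ∷ B<y) with s ≤? z
  ... | yes s≤z = ∸-monoˡ-< z<y s≤z ∷ next-< B<y
  ... | no _    = []

  next-decreasing : ∀ {B} → AllPairs _>_ B → AllPairs _>_ (next B)
  next-decreasing {[]}    _             = []
  next-decreasing {y ∷ B} (y>B ∷ B-dec) with s ≤? y
  ... | yes _ = next-< y>B ∷ next-decreasing B-dec
  ... | no _  = []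

  ∈low⇒∈ : ∀ {B z} → z ∈ low B → z ∈ B
  ∈low⇒∈ {B} z∈ = subst (_ ∈_) (high++low B) (∈-++⁺ʳ (high B) z∈)

  ∈⇒∈low : ∀ {B z} → z ∈ B → z < s → z ∈ low B
  ∈⇒∈low {B} z∈ z<s′ with ∈-++⁻ (high B) (subst (_ ∈_) (sym (high++low B)) z∈)
  ... | inj₁ z∈high = ⊥-elim (<⇒≱ z<s′ (All.lookup (high-≥ B) z∈high))
  ... | inj₂ z∈low  = z∈low

  ∈⇒∈next : ∀ {B z} → AllPairs _>_ B → z ∈ B → s ≤ z → z ∸ s ∈ next B
  ∈⇒∈next {B} B-dec z∈ s≤z with ∈-++⁻ (high B) (subst (_ ∈_) (sym (high++low B)) z∈)
  ... | inj₁ z∈high = ∈-map⁺ (_∸ s) z∈high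
  ... | inj₂ z∈low  = ⊥-elim (<⇒≱ (All.lookup (low-< B-dec) z∈low) s≤z)

  ∈next⁻ : ∀ {B x} → x ∈ next B → ∃[ z ] z ∈ B × s ≤ z × x ≡ z ∸ s
  ∈next⁻ {B} x∈ with ∈-map⁻ (_∸ s) x∈
  ... | z , z∈high , x≡ = z , subst (_ ∈_) (high++low B) (∈-++⁺ˡ z∈high) ,
                          All.lookup (high-≥ B) z∈high , x≡

  length≡next+low : ∀ B → length B ≡ length (next B) + length (low B)
  length≡next+low B = begin
    length B                        ≡⟨ cong length (sym (high++low B)) ⟩
    length (high B ++ low B)        ≡⟨ length-++ (high B) ⟩
    length (high B) + length (low B) ≡⟨ cong (_+ length (low B)) (sym (length-map (_∸ s) (high B))) ⟩
    length (next B) + length (low B) ∎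
    where open ≡-Reasoning

  next-subClosed : ∀ {t B} → AllPairs _>_ B → SubClosed t B → SubClosed t (next B)
  next-subClosed {t} {B} B-dec closed x∈ t≤x with ∈next⁻ {B} x∈
  ... | z , z∈ , s≤z , refl = subst (_∈ next B) shifted (∈⇒∈next B-dec (closed z∈ t≤z) s≤z-t)
    where
    t+s≤z : t + s ≤ z
    t+s≤z = m≤o∸n⇒m+n≤o t s≤z t≤x
    t≤z = ≤-trans (m≤m+n t s) t+s≤z
    s≤z-t : s ≤ z ∸ t
    s≤z-t = m+n≤o⇒m≤o∸n s (subst (_≤ z) (+-comm t s) t+s≤z)
    shifted : z ∸ t ∸ s ≡ z ∸ s ∸ t
    shifted = begin
      z ∸ t ∸ s   ≡⟨ ∸-+-assoc z t s ⟩
      z ∸ (t + s) ≡⟨ cong (z ∸_) (+-comm t s) ⟩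
      z ∸ (s + t) ≡⟨ sym (∸-+-assoc z s t) ⟩
      z ∸ s ∸ t   ∎
      where open ≡-Reasoning

  next-positive : ∀ {B} → SubClosed s B → All (0 <_) B → All (0 <_) (next B)
  next-positive {B} closed positive = All.tabulate λ x∈ → positiveAt (∈next⁻ {B} x∈)
    where
    positiveAt : ∀ {x} → ∃[ z ] z ∈ B × s ≤ z × x ≡ z ∸ s → 0 < x
    positiveAt (z , z∈ , s≤z , refl) = All.lookup positive (closed z∈ s≤z)

  next-<* : ∀ {n B} → All (_< suc n * s) B → All (_< n * s) (next B)
  next-<* {n} {B} B< = All.tabulate λ x∈ → below (∈next⁻ {B} x∈)
    where
    below : ∀ {x} → ∃[ z ] z ∈ B × s ≤ z × x ≡ z ∸ s → x < n * s
    below (z , z∈ , s≤z , refl) = subst (z ∸ s <_) (m+n∸m≡n s (n * s)) (∸-monoˡ-< (All.lookup B< z∈) s≤z)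

  liftedSize-layers : ∀ l B → AllPairs _>_ B → length (low B) ≤ s →
    liftedSize l B ≡ liftedSize l (low B) + liftedSize (l + (s ∸ length (low B))) (next B)
  liftedSize-layers l []      _ _ = sym (trans (cong (liftedSize l [] +_) (liftedSize-[] (l + s))) (+-identityʳ _))
  liftedSize-layers l (y ∷ B) (y>B ∷ B-dec) a≤s with s ≤? y
  ... | no _    = sym (trans (cong (liftedSize l (y ∷ B) +_) (liftedSize-[] (l + (s ∸ length (y ∷ B))))) (+-identityʳ _))
  ... | yes s≤y = begin
    l * suc n + (y ∸ n + betaSize B)
      ≡⟨ regroup l n (y ∸ n) (betaSize B) ⟩
    liftedSize l B + (l + (y ∸ n))
      ≡⟨ cong₂ _+_ (liftedSize-layers l B B-dec a≤s) (cong (λ m → l + (y ∸ m)) (length≡next+low B)) ⟩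
    (X + ((l + E) * b + betaSize (next B))) + (l + (y ∸ (b + a)))
      ≡⟨ cong (λ z → X + ((l + E) * b + betaSize (next B)) + (l + z)) topOfLayer ⟩
    (X + ((l + E) * b + betaSize (next B))) + (l + (E + (y ∸ s ∸ b)))
      ≡⟨ regroup′ X l E b (betaSize (next B)) (y ∸ s ∸ b) ⟩
    X + ((l + E) * suc b + (y ∸ s ∸ b + betaSize (next B))) ∎
    where
    open ≡-Reasoning
    n = length B
    a = length (low B)
    b = length (next B)
    E = s ∸ a
    X = liftedSize l (low B)
    b≤y-s : b ≤ y ∸ s
    b≤y-s = length≤head (next-< y>B ∷ next-decreasing B-dec)
    topOfLayer : y ∸ (b + a) ≡ E + (y ∸ s ∸ b)
    topOfLayer = begin
      y ∸ (b + a)             ≡⟨ cong (y ∸_) (+-comm b a) ⟩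
      y ∸ (a + b)             ≡⟨ sym (∸-+-assoc y a b) ⟩
      y ∸ a ∸ b               ≡⟨ cong (λ z → z ∸ a ∸ b) (sym (m+[n∸m]≡n s≤y)) ⟩
      s + (y ∸ s) ∸ a ∸ b     ≡⟨ cong (_∸ b) (+-∸-comm (y ∸ s) a≤s) ⟩
      E + (y ∸ s) ∸ b         ≡⟨ +-∸-assoc E b≤y-s ⟩
      E + (y ∸ s ∸ b)         ∎
    regroup : ∀ l n c S → l * suc n + (c + S) ≡ (l * n + S) + (l + c)
    regroup = solve-∀
    regroup′ : ∀ X l E b S c → (X + ((l + E) * b + S)) + (l + (E + c)) ≡ X + ((l + E) * suc b + (c + S))
    regroup′ = solve-∀

  -- Subtract s, s+1 and s+2 from the element x + s of B; x ≥ 2 because 0 is not a β-number.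
  low-next-member : ∀ {B} → AllPairs _>_ B → SubClosed₃ s B → All (0 <_) B → ∀ {x} → x ∈ low (next B) →
    2 ≤ x × (x ∈ low B × x ∸ 1 ∈ low B × x ∸ 2 ∈ low B)
  low-next-member {B} B-dec closed positive {x} x∈ with ∈next⁻ {B} (∈low⇒∈ {next B} x∈)
  ... | z , z∈ , s≤z , refl = 2≤x , memberAt 0 z≤n z≤n , memberAt 1 (s≤s z≤n) (≤-trans (s≤s z≤n) 2≤x) , memberAt 2 ≤-refl 2≤x
    where
    x<s : z ∸ s < s
    x<s = All.lookup (low-< (next-decreasing B-dec)) x∈
    memberAt : ∀ d → d ≤ 2 → d ≤ z ∸ s → z ∸ s ∸ d ∈ low B
    memberAt d d≤2 d≤x = ∈⇒∈low (subst (_∈ B) reorder (closed d d≤2 z∈ (m≤o∸n⇒m+n≤o d s≤z d≤x))) (≤-<-trans (m∸n≤m _ d) x<s)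
      where
      reorder : z ∸ (d + s) ≡ z ∸ s ∸ d
      reorder = trans (cong (z ∸_) (+-comm d s)) (sym (∸-+-assoc z s d))
    1≤x : 1 ≤ z ∸ s
    1≤x = All.lookup positive (closed 0 z≤n z∈ s≤z)
    2≤x : 2 ≤ z ∸ s
    2≤x = ≤∧≢⇒< 1≤x λ 1≡x → <-irrefl refl
      (subst (λ x → 0 < x ∸ 1) (sym 1≡x) (All.lookup positive (∈low⇒∈ {B} (memberAt 1 (s≤s z≤n) 1≤x))))

  low-next-shrinks : ∀ {B} → AllPairs _>_ B → SubClosed₃ s B → All (0 <_) B → length (low (next B)) ≤ length (low B) ∸ 2
  low-next-shrinks {B} B-dec closed positive
    with low (next B) | low-decreasing (next-decreasing B-dec) | (λ {x} → low-next-member {B} B-dec closed positive {x})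
  ... | []    | _     | _      = z≤n
  ... | x ∷ A | A-dec | member = m+n≤o⇒m≤o∸n (length (x ∷ A))
    (length+2≤ A-dec (All.tabulate (λ z∈ → proj₁ (member z∈))) (low-decreasing B-dec) (λ z∈ → proj₂ (member z∈)))

  -- The lifted size of the β-set whose i-th layer [i s, (i+1) s) is filled from the top by aᵢ elements.
  stairSize : ℕ → List ℕ → ℕ
  stairSize l []       = 0
  stairSize l (a ∷ as) = a * (l + (s ∸ a)) + stairSize (l + (s ∸ a)) as

  stairSize-+ : ∀ m l as → stairSize (m + l) as ≡ m * sum as + stairSize l as
  stairSize-+ m l []       = sym (trans (+-identityʳ (m * 0)) (*-zeroʳ m))
  stairSize-+ m l (a ∷ as) = begin
    a * (m + l + (s ∸ a)) + stairSize (m + l + (s ∸ a)) as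
      ≡⟨ cong (λ z → a * z + stairSize z as) (+-assoc m l (s ∸ a)) ⟩
    a * (m + L) + stairSize (m + L) as
      ≡⟨ cong (a * (m + L) +_) (stairSize-+ m L as) ⟩
    a * (m + L) + (m * sum as + stairSize L as)
      ≡⟨ regroup a m L (sum as) (stairSize L as) ⟩
    m * (a + sum as) + (a * L + stairSize L as) ∎
    where
    open ≡-Reasoning
    L = l + (s ∸ a)
    regroup : ∀ a m L S P → a * (m + L) + (m * S + P) ≡ m * (a + S) + (a * L + P)
    regroup = solve-∀

  stairSize-lift : ∀ l as → stairSize l as ≡ l * sum as + stairSize 0 as
  stairSize-lift l as = trans (cong (λ m → stairSize m as) (sym (+-identityʳ l))) (stairSize-+ l 0 as)

  stairSize-stair : ∀ l a → stairSize l (stair a) ≡ a * (l + (s ∸ a)) + stairSize (l + (s ∸ a)) (stair (a ∸ 2))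
  stairSize-stair l zero          = refl
  stairSize-stair l (suc zero)    = refl
  stairSize-stair l (suc (suc a)) = refl

  stairTotal : ℕ → ℕ
  stairTotal c = stairSize 0 (stair c)

  stairTotal-step : ∀ c r → 2 + c + r ≡ s → stairTotal (2 + c) ≡ (2 + c) * r + (r * sum (stair c) + stairTotal c)
  stairTotal-step c r eq = begin
    (2 + c) * (s ∸ (2 + c)) + stairSize (s ∸ (2 + c)) (stair c)
      ≡⟨ cong (λ e → (2 + c) * e + stairSize e (stair c)) s∸[2+c]≡r ⟩
    (2 + c) * r + stairSize r (stair c)
      ≡⟨ cong ((2 + c) * r +_) (stairSize-lift r (stair c)) ⟩
    (2 + c) * r + (r * sum (stair c) + stairTotal c) ∎
    where
    open ≡-Reasoning
    s∸[2+c]≡r : s ∸ (2 + c) ≡ r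
    s∸[2+c]≡r = trans (cong (_∸ (2 + c)) (sym eq)) (m+n∸m≡n (2 + c) r)

  stairTotal-even : ∀ u r → 2 * u + 1 + r ≡ s → 6 * stairTotal (2 * u) ≡ u * (1 + u) * (2 + u) * (1 + u + 2 * r)
  stairTotal-even zero    r eq = refl
  stairTotal-even (suc u) r eq = begin
    6 * stairTotal (2 * suc u)
      ≡⟨ cong (λ c → 6 * stairTotal c) (*-suc 2 u) ⟩
    6 * stairTotal (2 + 2 * u)
      ≡⟨ cong (6 *_) (stairTotal-step (2 * u) (1 + r) (trans (shift₁ u r) eq)) ⟩
    6 * ((2 + 2 * u) * (1 + r) + ((1 + r) * sum (stair (2 * u)) + stairTotal (2 * u)))
      ≡⟨ cong (λ t → 6 * ((2 + 2 * u) * (1 + r) + ((1 + r) * t + stairTotal (2 * u)))) (sum-stair-even u) ⟩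
    6 * ((2 + 2 * u) * (1 + r) + ((1 + r) * (u * (1 + u)) + stairTotal (2 * u)))
      ≡⟨ distrib ((2 + 2 * u) * (1 + r)) ((1 + r) * (u * (1 + u))) (stairTotal (2 * u)) ⟩
    6 * ((2 + 2 * u) * (1 + r) + (1 + r) * (u * (1 + u))) + 6 * stairTotal (2 * u)
      ≡⟨ cong (6 * ((2 + 2 * u) * (1 + r) + (1 + r) * (u * (1 + u))) +_) (stairTotal-even u (2 + r) (trans (shift₂ u r) eq)) ⟩
    6 * ((2 + 2 * u) * (1 + r) + (1 + r) * (u * (1 + u))) + u * (1 + u) * (2 + u) * (1 + u + 2 * (2 + r))
      ≡⟨ closedForm u r ⟩
    suc u * (1 + suc u) * (2 + suc u) * (1 + suc u + 2 * r) ∎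
    where
    open ≡-Reasoning
    shift₁ : ∀ u r → 2 + 2 * u + (1 + r) ≡ 2 * suc u + 1 + r
    shift₁ = solve-∀
    shift₂ : ∀ u r → 2 * u + 1 + (2 + r) ≡ 2 * suc u + 1 + r
    shift₂ = solve-∀
    distrib : ∀ a b x → 6 * (a + (b + x)) ≡ 6 * (a + b) + 6 * x
    distrib = solve-∀
    closedForm : ∀ u r → 6 * ((2 + 2 * u) * (1 + r) + (1 + r) * (u * (1 + u))) + u * (1 + u) * (2 + u) * (1 + u + 2 * (2 + r))
                         ≡ (1 + u) * (2 + u) * (3 + u) * (2 + u + 2 * r)
    closedForm = solve-∀

  stairTotal-odd : ∀ u r → 2 * u + 1 + r ≡ s → 6 * stairTotal (1 + 2 * u) ≡ (1 + u) * (2 + u) * (u * (1 + u) + r * (2 * u + 3))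
  stairTotal-odd zero    r eq = trans (cong (λ e → 6 * (1 * e + 0)) (cong (_∸ 1) (sym eq))) (closedForm r)
    where
    closedForm : ∀ r → 6 * (1 * r + 0) ≡ 1 * 2 * (0 * 1 + r * 3)
    closedForm = solve-∀
  stairTotal-odd (suc u) r eq = begin
    6 * stairTotal (1 + 2 * suc u)
      ≡⟨ cong (λ c → 6 * stairTotal (1 + c)) (*-suc 2 u) ⟩
    6 * stairTotal (2 + (1 + 2 * u))
      ≡⟨ cong (6 *_) (stairTotal-step (1 + 2 * u) r (trans (shift₁ u r) eq)) ⟩
    6 * ((3 + 2 * u) * r + (r * sum (stair (1 + 2 * u)) + stairTotal (1 + 2 * u)))
      ≡⟨ cong (λ t → 6 * ((3 + 2 * u) * r + (r * t + stairTotal (1 + 2 * u)))) (sum-stair-odd u) ⟩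
    6 * ((3 + 2 * u) * r + (r * ((1 + u) * (1 + u)) + stairTotal (1 + 2 * u)))
      ≡⟨ distrib ((3 + 2 * u) * r) (r * ((1 + u) * (1 + u))) (stairTotal (1 + 2 * u)) ⟩
    6 * ((3 + 2 * u) * r + r * ((1 + u) * (1 + u))) + 6 * stairTotal (1 + 2 * u)
      ≡⟨ cong (6 * ((3 + 2 * u) * r + r * ((1 + u) * (1 + u))) +_) (stairTotal-odd u (2 + r) (trans (shift₂ u r) eq)) ⟩
    6 * ((3 + 2 * u) * r + r * ((1 + u) * (1 + u))) + (1 + u) * (2 + u) * (u * (1 + u) + (2 + r) * (2 * u + 3))
      ≡⟨ closedForm u r ⟩
    (1 + suc u) * (2 + suc u) * (suc u * (1 + suc u) + r * (2 * suc u + 3)) ∎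
    where
    open ≡-Reasoning
    shift₁ : ∀ u r → 2 + (1 + 2 * u) + r ≡ 2 * suc u + 1 + r
    shift₁ = solve-∀
    shift₂ : ∀ u r → 2 * u + 1 + (2 + r) ≡ 2 * suc u + 1 + r
    shift₂ = solve-∀
    distrib : ∀ a b x → 6 * (a + (b + x)) ≡ 6 * (a + b) + 6 * x
    distrib = solve-∀
    closedForm : ∀ u r → 6 * ((3 + 2 * u) * r + r * ((1 + u) * (1 + u))) + (1 + u) * (2 + u) * (u * (1 + u) + (2 + r) * (2 * u + 3))
                         ≡ (2 + u) * (3 + u) * ((1 + u) * (2 + u) + r * (2 * (1 + u) + 3))
    closedForm = solve-∀

  stairTotal-mono₁ : ∀ c → 2 + c ≤ s → stairTotal c ≤ stairTotal (suc c)
  stairTotal-mono₁ c 2+c≤s with evenOrOdd c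
  ... | even u = *-cancelˡ-≤ 6 (subst₂ _≤_ (sym (stairTotal-even u r eq)) (sym (stairTotal-odd u r eq)) (gap u r))
    where
    r = s ∸ (2 * u + 1)
    eq : 2 * u + 1 + r ≡ s
    eq = m+[n∸m]≡n (subst (_≤ s) (+-comm 1 (2 * u)) (<⇒≤ 2+c≤s))
    gap : ∀ u r → u * (1 + u) * (2 + u) * (1 + u + 2 * r) ≤ (1 + u) * (2 + u) * (u * (1 + u) + r * (2 * u + 3))
    gap u r = subst (u * (1 + u) * (2 + u) * (1 + u + 2 * r) ≤_) (sym (difference u r)) (m≤m+n _ _)
      where
      difference : ∀ u r → (1 + u) * (2 + u) * (u * (1 + u) + r * (2 * u + 3))
                           ≡ u * (1 + u) * (2 + u) * (1 + u + 2 * r) + 3 * r * ((1 + u) * (2 + u))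
      difference = solve-∀
  ... | odd u = *-cancelˡ-≤ 6 (subst₂ _≤_ (sym (stairTotal-odd u (2 + r) eqOdd))
                                            (sym (trans (cong (λ c → 6 * stairTotal c) (sym (*-suc 2 u))) (stairTotal-even (suc u) r eqEven)))
                                            (gap u r))
    where
    r = s ∸ (2 * suc u + 1)
    eqEven : 2 * suc u + 1 + r ≡ s
    eqEven = m+[n∸m]≡n (subst (_≤ s) (shift u) 2+c≤s)
      where shift : ∀ u → 2 + (1 + 2 * u) ≡ 2 * suc u + 1
            shift = solve-∀
    eqOdd : 2 * u + 1 + (2 + r) ≡ s
    eqOdd = trans (shift u r) eqEven
      where shift : ∀ u r → 2 * u + 1 + (2 + r) ≡ 2 * suc u + 1 + r
            shift = solve-∀
    gap : ∀ u r → (1 + u) * (2 + u) * (u * (1 + u) + (2 + r) * (2 * u + 3))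
                  ≤ suc u * (1 + suc u) * (2 + suc u) * (1 + suc u + 2 * r)
    gap u r = subst ((1 + u) * (2 + u) * (u * (1 + u) + (2 + r) * (2 * u + 3)) ≤_) (sym (difference u r)) (m≤m+n _ _)
      where
      difference : ∀ u r → suc u * (1 + suc u) * (2 + suc u) * (1 + suc u + 2 * r)
                           ≡ (1 + u) * (2 + u) * (u * (1 + u) + (2 + r) * (2 * u + 3)) + 3 * r * ((1 + u) * (2 + u))
      difference = solve-∀

  stairSize-mono : ∀ l {a c} → a ≤ c → c < s → stairSize l (stair a) ≤ stairSize l (stair c)
  stairSize-mono l {a} {zero}  z≤n _   = ≤-refl
  stairSize-mono l {a} {suc c} a≤1+c 1+c<s with m≤n⇒m<n∨m≡n a≤1+c
  ... | inj₂ refl      = ≤-refl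
  ... | inj₁ (s≤s a≤c) = ≤-trans (stairSize-mono l a≤c (<-trans (n<1+n c) 1+c<s)) step
    where
    step : stairSize l (stair c) ≤ stairSize l (stair (suc c))
    step = subst₂ _≤_ (sym (stairSize-lift l (stair c))) (sym (stairSize-lift l (stair (suc c))))
             (+-mono-≤ (*-monoʳ-≤ l (sum-stair-mono₁ c)) (stairTotal-mono₁ c 1+c<s))

  layer-bound : ∀ n l c {B} → c < s → AllPairs _>_ B → All (0 <_) B → SubClosed₃ s B → All (_< n * s) B →
    length (low B) ≤ c → liftedSize l B ≤ stairSize l (stair c)
  layer-bound zero    l c {[]}    _ _ _ _ _        _ = subst (_≤ stairSize l (stair c)) (sym (liftedSize-[] l)) z≤n
  layer-bound zero    l c {y ∷ B} _ _ _ _ (() ∷ _) _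
  layer-bound (suc n) l c {B} c<s B-dec positive closed B< a≤c = begin
    liftedSize l B
      ≡⟨ liftedSize-layers l B B-dec a≤s ⟩
    liftedSize l (low B) + liftedSize (l + (s ∸ a)) (next B)
      ≤⟨ +-mono-≤ lowBound nextBound ⟩
    a * (l + (s ∸ a)) + stairSize (l + (s ∸ a)) (stair (a ∸ 2))
      ≡⟨ stairSize-stair l a ⟨
    stairSize l (stair a)
      ≤⟨ stairSize-mono l a≤c c<s ⟩
    stairSize l (stair c) ∎
    where
    open ≤-Reasoning
    a = length (low B)
    a≤s = ≤-trans a≤c (<⇒≤ c<s)
    lowBound : liftedSize l (low B) ≤ a * (l + (s ∸ a))
    lowBound = subst (l * a + betaSize (low B) ≤_) (distrib l a (s ∸ a))
                 (+-monoʳ-≤ (l * a) (betaSize≤ (low-decreasing B-dec) (low-< B-dec)))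
      where distrib : ∀ l a e → l * a + a * e ≡ a * (l + e)
            distrib = solve-∀
    nextBound : liftedSize (l + (s ∸ a)) (next B) ≤ stairSize (l + (s ∸ a)) (stair (a ∸ 2))
    nextBound = layer-bound n (l + (s ∸ a)) (a ∸ 2) (≤-<-trans (m∸n≤m a 2) (≤-<-trans a≤c c<s))
      (next-decreasing B-dec) (next-positive (closed 0 z≤n) positive)
      (λ d d≤2 → next-subClosed B-dec (closed d d≤2)) (next-<* {n} B<) (low-next-shrinks B-dec closed positive)

  betaSize≤stairTotal : 0 < s → ∀ {B} → AllPairs _>_ B → All (0 <_) B → SubClosed₃ s B → betaSize B ≤ stairTotal (pred s)
  betaSize≤stairTotal 0<s {B} B-dec positive closed =
    layer-bound (suc (sum B)) 0 (pred s) (≤-reflexive (suc-pred s)) B-dec positive closed B<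
      (length≤pred (low-decreasing B-dec) (All.tabulate (λ z∈ → All.lookup positive (∈low⇒∈ {B} z∈))) (low-< B-dec))
    where
    instance _ = >-nonZero 0<s
    B< : All (_< suc (sum B) * s) B
    B< = All.tabulate λ b∈ → <-≤-trans (s≤s (∈⇒≤sum b∈)) (subst (_≤ suc (sum B) * s) (*-identityʳ _) (*-monoʳ-≤ (suc (sum B)) 0<s))

module Kappa (k₀ : ℕ) where

  s : ℕ
  s = 1 + 2 * k₀

  block : ℕ → List ℕ
  block m = replicate (2 * (k₀ ∸ m)) (suc m * suc m)

  -- kappaFormula (suc k₀) unfolds to kappaUpTo k₀.
  kappaUpTo : ℕ → List ℕ
  kappaUpTo n = concat (map block (downFrom n))

  kappaUpTo-≤ : ∀ n → All (_≤ n * n) (kappaUpTo n)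
  kappaUpTo-≤ zero    = []
  kappaUpTo-≤ (suc n) = All-++⁺ (replicate⁺ _ ≤-refl) (All.map (λ x≤ → ≤-trans x≤ n*n≤) (kappaUpTo-≤ n))
    where n*n≤ = *-mono-≤ (n≤1+n n) (n≤1+n n)

  kappaUpTo-positive : ∀ n → All (0 <_) (kappaUpTo n)
  kappaUpTo-positive zero    = []
  kappaUpTo-positive (suc n) = All-++⁺ (replicate⁺ _ (s≤s z≤n)) (kappaUpTo-positive n)

  kappaUpTo-decreasing : ∀ n → AllPairs _≥_ (kappaUpTo n)
  kappaUpTo-decreasing zero    = []
  kappaUpTo-decreasing (suc n) = AllPairs.++⁺ (allPairs-replicate _ ≤-refl) (kappaUpTo-decreasing n)
    (replicate⁺ _ (All.map (λ x≤ → ≤-trans x≤ (*-mono-≤ (n≤1+n n) (n≤1+n n))) (kappaUpTo-≤ n)))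

  private
    k₀∸n≡1+d : ∀ n d → suc n + d ≡ k₀ → k₀ ∸ n ≡ suc d
    k₀∸n≡1+d n d eq = trans (cong (_∸ n) (trans (sym eq) (sym (+-suc n d)))) (m+n∸m≡n n (suc d))

    shift : ∀ n d → suc n + d ≡ k₀ → n + suc d ≡ k₀
    shift n d eq = trans (+-suc n d) eq

  length-kappaUpTo : ∀ n d → n + d ≡ k₀ → length (kappaUpTo n) + n * n ≡ n * s
  length-kappaUpTo zero    d _  = refl
  length-kappaUpTo (suc n) d eq = begin
    length (block n ++ kappaUpTo n) + suc n * suc n
      ≡⟨ cong (_+ suc n * suc n) (length-++ (block n)) ⟩
    length (block n) + L + suc n * suc n
      ≡⟨ cong (λ c → c + L + suc n * suc n) (trans (length-replicate _) (cong (2 *_) (k₀∸n≡1+d n d eq))) ⟩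
    2 * suc d + L + suc n * suc n
      ≡⟨ regroup (suc d) L n ⟩
    2 * suc d + (2 * n + 1) + (L + n * n)
      ≡⟨ cong (2 * suc d + (2 * n + 1) +_) (length-kappaUpTo n (suc d) (shift n d eq)) ⟩
    2 * suc d + (2 * n + 1) + n * s
      ≡⟨ cong (λ k → 2 * suc d + (2 * n + 1) + n * (1 + 2 * k)) (sym eq) ⟩
    2 * suc d + (2 * n + 1) + n * (1 + 2 * (suc n + d))
      ≡⟨ closedForm n d ⟩
    suc n * (1 + 2 * (suc n + d))
      ≡⟨ cong (λ k → suc n * (1 + 2 * k)) eq ⟩
    suc n * s ∎
    where
    open ≡-Reasoning
    L = length (kappaUpTo n)
    regroup : ∀ e L n → 2 * e + L + (1 + n) * (1 + n) ≡ 2 * e + (2 * n + 1) + (L + n * n)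
    regroup = solve-∀
    closedForm : ∀ n d → 2 * (1 + d) + (2 * n + 1) + n * (1 + 2 * (1 + n + d)) ≡ (1 + n) * (1 + 2 * (1 + n + d))
    closedForm = solve-∀

  size-kappaUpTo : ∀ n d → n + d ≡ k₀ → 6 * size (kappaUpTo n) ≡ n * (1 + n) * ((1 + n) * (2 + n) + 2 * d * (2 * n + 1))
  size-kappaUpTo zero    d _  = refl
  size-kappaUpTo (suc n) d eq = begin
    6 * sum (block n ++ kappaUpTo n)
      ≡⟨ cong (6 *_) (sum-++ (block n) (kappaUpTo n)) ⟩
    6 * (sum (block n) + size (kappaUpTo n))
      ≡⟨ cong (λ b → 6 * (b + size (kappaUpTo n))) (trans (sum-replicate (2 * (k₀ ∸ n)) (suc n * suc n)) (cong (λ e → 2 * e * (suc n * suc n)) (k₀∸n≡1+d n d eq))) ⟩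
    6 * (2 * suc d * (suc n * suc n) + size (kappaUpTo n))
      ≡⟨ *-distribˡ-+ 6 (2 * suc d * (suc n * suc n)) (size (kappaUpTo n)) ⟩
    6 * (2 * suc d * (suc n * suc n)) + 6 * size (kappaUpTo n)
      ≡⟨ cong (6 * (2 * suc d * (suc n * suc n)) +_) (size-kappaUpTo n (suc d) (shift n d eq)) ⟩
    6 * (2 * suc d * (suc n * suc n)) + n * (1 + n) * ((1 + n) * (2 + n) + 2 * suc d * (2 * n + 1))
      ≡⟨ closedForm n d ⟩
    suc n * (1 + suc n) * ((1 + suc n) * (2 + suc n) + 2 * d * (2 * suc n + 1)) ∎
    where
    open ≡-Reasoning
    closedForm : ∀ n d → 6 * (2 * (1 + d) * ((1 + n) * (1 + n))) + n * (1 + n) * ((1 + n) * (2 + n) + 2 * (1 + d) * (2 * n + 1))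
                         ≡ (1 + n) * (2 + n) * ((2 + n) * (3 + n) + 2 * d * (2 * (1 + n) + 1))
    closedForm = solve-∀

  ∉semigroup⇒betweenLayers : ∀ {y} → ¬ InSemigroup s y → ∃[ q ] q < k₀ × BetweenLayers s q y
  ∉semigroup⇒betweenLayers {y} y∉ = q , q<k₀ , lower , upper
    where
    q = y / s
    r = y % s
    y≡ : y ≡ r + q * s
    y≡ = m≡m%n+[m/n]*n y s
    q*[2+s] : ∀ q s → q * (2 + s) ≡ 2 * q + q * s
    q*[2+s] = solve-∀
    2q<r : 2 * q < r
    2q<r = ≰⇒> λ r≤2q → y∉ (q , subst (q * s ≤_) (sym y≡) (m≤n+m (q * s) r) ,
                                subst₂ _≤_ (sym y≡) (sym (q*[2+s] q s)) (+-monoˡ-≤ (q * s) r≤2q))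
    q<k₀ : q < k₀
    q<k₀ = ≰⇒> λ k₀≤q → <⇒≱ 2q<r (≤-trans (≤-pred (m%n<n y s)) (*-monoʳ-≤ 2 k₀≤q))
    lower : q * (2 + s) < y
    lower = subst₂ _<_ (sym (q*[2+s] q s)) (sym y≡) (+-monoˡ-< (q * s) 2q<r)
    upper : y < suc q * s
    upper = subst (_< suc q * s) (sym y≡) (+-monoˡ-< (q * s) (m%n<n y s))

  topBlock : ℕ → List ℕ
  topBlock n = map (_+ length (kappaUpTo n)) (betaNumbers (block n))

  module _ {n d} (eq : suc n + d ≡ k₀) where

    private
      L = length (kappaUpTo n)

      lowerEdge : suc n * suc n + L ≡ suc (n * (2 + s))
      lowerEdge = trans (regroup L n) (trans (cong (_+ (2 * n + 1)) (length-kappaUpTo n (suc d) (shift n d eq))) (closedForm n s))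
        where
        regroup : ∀ L n → (1 + n) * (1 + n) + L ≡ (L + n * n) + (2 * n + 1)
        regroup = solve-∀
        closedForm : ∀ n s → n * s + (2 * n + 1) ≡ suc (n * (2 + s))
        closedForm = solve-∀

      upperEdge : suc n * suc n + 2 * (k₀ ∸ n) + L ≡ suc n * s
      upperEdge = begin
        suc n * suc n + 2 * (k₀ ∸ n) + L ≡⟨ cong (λ e → suc n * suc n + 2 * e + L) (k₀∸n≡1+d n d eq) ⟩
        suc n * suc n + 2 * suc d + L     ≡⟨ regroup L n d ⟩
        2 * suc n + 1 + 2 * d + (L + n * n) ≡⟨ cong (2 * suc n + 1 + 2 * d +_) (length-kappaUpTo n (suc d) (shift n d eq)) ⟩
        2 * suc n + 1 + 2 * d + n * s       ≡⟨ cong (λ k → 2 * suc n + 1 + 2 * d + n * (1 + 2 * k)) (sym eq) ⟩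
        2 * suc n + 1 + 2 * d + n * (1 + 2 * (suc n + d)) ≡⟨ closedForm n d ⟩
        suc n * (1 + 2 * (suc n + d))     ≡⟨ cong (λ k → suc n * (1 + 2 * k)) eq ⟩
        suc n * s ∎
        where
        open ≡-Reasoning
        regroup : ∀ L n d → (1 + n) * (1 + n) + 2 * (1 + d) + L ≡ 2 * (1 + n) + 1 + 2 * d + (L + n * n)
        regroup = solve-∀
        closedForm : ∀ n d → 2 * (1 + n) + 1 + 2 * d + n * (1 + 2 * (1 + n + d)) ≡ (1 + n) * (1 + 2 * (1 + n + d))
        closedForm = solve-∀

    ∈topBlock⁻ : ∀ {y} → y ∈ topBlock n → BetweenLayers s n y
    ∈topBlock⁻ y∈ with ∈-map⁻ (_+ L) y∈
    ... | z , z∈ , refl with ∈betaNumbers-replicate⁻ (2 * (k₀ ∸ n)) (suc n * suc n) z∈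
    ... | v≤z , z<v+c = subst (_≤ z + L) lowerEdge (+-monoˡ-≤ L v≤z) ,
                         subst (z + L <_) upperEdge (+-monoˡ-< L z<v+c)

    ∈topBlock⁺ : ∀ {y} → BetweenLayers s n y → y ∈ topBlock n
    ∈topBlock⁺ {y} (lower , upper) =
      subst (_∈ topBlock n) (m∸n+n≡m L≤y)
        (∈-map⁺ (_+ L) (∈betaNumbers-replicate⁺ (2 * (k₀ ∸ n)) (suc n * suc n) v≤y∸L y∸L<v+c))
      where
      v+L≤y : suc n * suc n + L ≤ y
      v+L≤y = subst (_≤ y) (sym lowerEdge) lower
      L≤y = ≤-trans (m≤n+m L _) v+L≤y
      v≤y∸L = m+n≤o⇒m≤o∸n (suc n * suc n) v+L≤y
      y∸L<v+c : y ∸ L < suc n * suc n + 2 * (k₀ ∸ n)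
      y∸L<v+c = subst (y ∸ L <_) (m+n∸n≡m _ L) (∸-monoˡ-< (subst (y <_) (sym upperEdge) upper) L≤y)

  ∈betaNumbers-kappaUpTo⁻ : ∀ n d → n + d ≡ k₀ → ∀ {y} → y ∈ betaNumbers (kappaUpTo n) → ∃[ q ] q < n × BetweenLayers s q y
  ∈betaNumbers-kappaUpTo⁻ (suc n) d eq {y} y∈
    with ∈-++⁻ (topBlock n) (subst (y ∈_) (betaNumbers-++ (block n) (kappaUpTo n)) y∈)
  ... | inj₁ y∈top = n , n<1+n n , ∈topBlock⁻ {n} {d} eq y∈top
  ... | inj₂ y∈rest with ∈betaNumbers-kappaUpTo⁻ n (suc d) (shift n d eq) y∈rest
  ... | q , q<n , between = q , m<n⇒m<1+n q<n , between

  ∈betaNumbers-kappaUpTo⁺ : ∀ n d → n + d ≡ k₀ → ∀ {q y} → q < n → BetweenLayers s q y → y ∈ betaNumbers (kappaUpTo n)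
  ∈betaNumbers-kappaUpTo⁺ (suc n) d eq {q} {y} (s≤s q≤n) between =
    subst (y ∈_) (sym (betaNumbers-++ (block n) (kappaUpTo n))) y∈
    where
    y∈ : y ∈ topBlock n ++ betaNumbers (kappaUpTo n)
    y∈ with m≤n⇒m<n∨m≡n q≤n
    ... | inj₂ refl = ∈-++⁺ˡ (∈topBlock⁺ {n} {d} eq between)
    ... | inj₁ q<n  = ∈-++⁺ʳ (topBlock n) (∈betaNumbers-kappaUpTo⁺ n (suc d) (shift n d eq) q<n between)

module KappaMaximal (k₀ : ℕ) where
  open Kappa k₀
  open Layers s

  private
    κ = kappaFormula (suc k₀)

    k₀+0≡k₀ : k₀ + 0 ≡ k₀
    k₀+0≡k₀ = +-identityʳ k₀

    t₀ : 2 * suc k₀ ∸ 1 ≡ 0 + s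
    t₀ = +-suc k₀ (k₀ + 0)

    t₁ : 2 * suc k₀ ≡ 1 + s
    t₁ = cong suc t₀

    t₂ : 2 * suc k₀ + 1 ≡ 2 + s
    t₂ = trans (+-comm (2 * suc k₀) 1) (cong suc t₁)

  isCore3⇒subClosed₃ : ∀ {μ} → AllPairs _≥_ μ → IsCore3 (suc k₀) μ → SubClosed₃ s (betaNumbers μ)
  isCore3⇒subClosed₃ {μ} μ-dec (core₀ , _ , _) 0 _ = core⇒subClosed (s≤s z≤n) μ-dec (subst (λ t → IsCore t μ) t₀ core₀)
  isCore3⇒subClosed₃ {μ} μ-dec (_ , core₁ , _) 1 _ = core⇒subClosed (s≤s z≤n) μ-dec (subst (λ t → IsCore t μ) t₁ core₁)
  isCore3⇒subClosed₃ {μ} μ-dec (_ , _ , core₂) 2 _ = core⇒subClosed (s≤s z≤n) μ-dec (subst (λ t → IsCore t μ) t₂ core₂)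
  isCore3⇒subClosed₃ _ _ (suc (suc (suc _))) (s≤s (s≤s ()))

  subClosed₃⇒isCore3 : ∀ {μ} → AllPairs _≥_ μ → SubClosed₃ s (betaNumbers μ) → IsCore3 (suc k₀) μ
  subClosed₃⇒isCore3 {μ} μ-dec closed =
    subst (λ t → IsCore t μ) (sym t₀) (subClosed⇒core (s≤s z≤n) μ-dec (closed 0 z≤n)) ,
    subst (λ t → IsCore t μ) (sym t₁) (subClosed⇒core (s≤s z≤n) μ-dec (closed 1 (s≤s z≤n))) ,
    subst (λ t → IsCore t μ) (sym t₂) (subClosed⇒core (s≤s z≤n) μ-dec (closed 2 (s≤s (s≤s z≤n))))

  ∈kappa⇒∉semigroup : ∀ {y} → y ∈ betaNumbers κ → ¬ InSemigroup s y
  ∈kappa⇒∉semigroup y∈ with ∈betaNumbers-kappaUpTo⁻ k₀ 0 k₀+0≡k₀ y∈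
  ... | q , _ , between = betweenLayers⇒∉semigroup {q = q} between

  ∉semigroup⇒∈kappa : ∀ {y} → ¬ InSemigroup s y → y ∈ betaNumbers κ
  ∉semigroup⇒∈kappa y∉ with ∉semigroup⇒betweenLayers y∉
  ... | _ , q<k₀ , between = ∈betaNumbers-kappaUpTo⁺ k₀ 0 k₀+0≡k₀ q<k₀ between

  kappa-isPartition : IsPartition κ
  kappa-isPartition = AllPairs⇒Linked (kappaUpTo-decreasing k₀) , kappaUpTo-positive k₀

  kappa-isCore3 : IsCore3 (suc k₀) κ
  kappa-isCore3 = subClosed₃⇒isCore3 (kappaUpTo-decreasing k₀)
    λ d d≤2 b∈ d+s≤b → ∉semigroup⇒∈kappa (∉semigroup-∸ (∈kappa⇒∉semigroup b∈) d≤2 d+s≤b)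

  size-kappa : size κ ≡ stairTotal (2 * k₀)
  size-kappa = *-cancelˡ-≡ (size κ) (stairTotal (2 * k₀)) 6
    (trans (size-kappaUpTo k₀ 0 k₀+0≡k₀) (trans (sameClosedForm k₀) (sym (stairTotal-even k₀ 0 (s≡ k₀)))))
    where
    s≡ : ∀ k → 2 * k + 1 + 0 ≡ 1 + 2 * k
    s≡ = solve-∀
    sameClosedForm : ∀ k → k * (1 + k) * ((1 + k) * (2 + k) + 2 * 0 * (2 * k + 1)) ≡ k * (1 + k) * (2 + k) * (1 + k + 2 * 0)
    sameClosedForm = solve-∀

  core-size≤kappa : ∀ {μ} → IsPartition μ → IsCore3 (suc k₀) μ → size μ ≤ size κ
  core-size≤kappa {μ} μ-part@(_ , positive) core =
    subst₂ _≤_ (sym (size≡betaSize∘betaNumbers μ)) (sym size-kappa)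
      (betaSize≤stairTotal (s≤s z≤n) (betaNumbers-decreasing μ-dec) (betaNumbers-positive positive) (isCore3⇒subClosed₃ μ-dec core))
    where μ-dec = partition-decreasing μ-part

  core≢kappa⇒shorter : ∀ {μ} → IsPartition μ → IsCore3 (suc k₀) μ → μ ≢ κ → length μ < length κ
  core≢kappa⇒shorter {μ} μ-part@(_ , positive) core μ≢κ
    with decreasing-⊆ (betaNumbers-decreasing μ-dec) (betaNumbers-decreasing (kappaUpTo-decreasing k₀)) β⊆
    where
    μ-dec = partition-decreasing μ-part
    β⊆ : betaNumbers μ ⊆ betaNumbers κ
    β⊆ y∈ = ∉semigroup⇒∈kappa (subClosed₃⇒∉semigroup (isCore3⇒subClosed₃ μ-dec core) (betaNumbers-positive positive) y∈)
  ... | ≤len , ≡len⇒≡ with m≤n⇒m<n∨m≡n (subst₂ _≤_ (length-betaNumbers μ) (length-betaNumbers κ) ≤len)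
  ... | inj₁ shorter = shorter
  ... | inj₂ sameLength = ⊥-elim (μ≢κ (betaNumbers-injective μ κ
          (≡len⇒≡ (trans (length-betaNumbers μ) (trans sameLength (sym (length-betaNumbers κ)))))))

theorem2p5 : (k : ℕ) → 2 ≤ k →
    IsPartition (kappaFormula k)
    × IsCore3 k (kappaFormula k)
    × ((μ : List ℕ) → IsPartition μ → IsCore3 k μ → size μ ≤ size (kappaFormula k))
    × ((μ : List ℕ) → IsPartition μ → IsCore3 k μ → size μ ≡ size (kappaFormula k) →
        μ ≢ kappaFormula k → length μ < length (kappaFormula k))
theorem2p5 zero    ()
theorem2p5 (suc k₀) _ =
  kappa-isPartition ,
  kappa-isCore3 ,
  (λ μ μ-part core → core-size≤kappa μ-part core) ,
  (λ μ μ-part core _ μ≢κ → core≢kappa⇒shorter μ-part core μ≢κ)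
  where open KappaMaximal k₀
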